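{- Let $n = p^k m^2$ be an odd perfect number, where $p$ is prime, $p \equiv k \equiv 1 \pmod 4$ and $\gcd(p,m)=1$. Then: (1) If $p \equiv 1 \pmod 8$, then $\sigma(p^k) \equiv k+1 \pmod 8$. (2) If $p \equiv 5 \pmod 8$ and $k \equiv 1 \pmod 8$, then $\sigma(p^k) \equiv 6 \pmod 8$. (3) If $p \equiv 5 \pmod 8$ and $k \equiv 5 \pmod 8$, then $\sigma(p^k) \equiv 2 \pmod 8$.
   Context: $\sigma(z)$ denotes the sum of the positive divisors of $z$. An odd perfect number is an odd positive integer $n$ with $\sigma(n) = 2n$. By Euler, any odd perfect number has the form $n = p^k m^2$ with $p$ prime, $p \equiv k \equiv 1 \pmod 4$ and $\gcd(p,m)=1$; $p$ is called the special prime. -}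

module Defs where

open import Data.Nat using (ℕ; zero; suc; _+_; _*_; _%_)
open import Data.Nat.Divisibility using (_∣?_)
open import Data.List using (List; filter; map; upTo)
open import Data.Nat.ListAction using (sum)
open import Relation.Binary.PropositionalEquality using (_≡_)
open import Data.Product using (_×_)

-- divisors of n: the positive d with d ≤ n and d ∣ n  (for n ≥ 1 these are all positive divisors)
divisors : ℕ → List ℕ
divisors n = filter (_∣? n) (map suc (upTo n))

σ : ℕ → ℕ
σ n = sum (divisors n)

OddPerfect : ℕ → Set
OddPerfect n = (n % 2 ≡ 1) × (σ n ≡ 2 * n)

{-# OPTIONS --safe #-}
-- Only the primality of p matters: the divisors of p ^ k are 1, p, …, p ^ k, so
-- σ (p ^ k) is the geometric sum 1 + p + ⋯ + p ^ k = 1 + p (1 + p (⋯)). Reducing this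
-- Horner form modulo 8 replaces p by p % 8. For p ≡ 1 it counts the k + 1 terms; for
-- p ≡ 5 the residues 1, 6, 7, 4, 5, 2, 3, 0 repeat with period 8, giving 6 for k ≡ 1
-- and 2 for k ≡ 5.
module Submission where

open import Defs
open import Data.Nat using (ℕ; zero; suc; _+_; _*_; _^_; _%_; _/_; _<_; _≤_; _∸_; NonZero; s≤s; s≤s⁻¹; nonTrivial⇒n>1)
open import Data.Nat.Properties
open import Data.Nat.DivMod using (%-distribˡ-+; %-distribˡ-*; m%n%n≡m%n; m≡m%n+[m/n]*n)
open import Data.Nat.Divisibility using (_∣_; _∣?_; divides; ∣-refl; ∣⇒≤; 0∣⇒≡0; ∣n⇒∣m*n; *-monoʳ-∣; *-cancelˡ-∣)
open import Data.Nat.Primality using (Prime; prime⇒nonZero; prime⇒nonTrivial; prime⇒irreducible)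
open import Data.Nat.Coprimality using (Coprime; coprime-divisor)
open import Data.Product using (_×_; _,_)
open import Data.Sum using (inj₁; inj₂)
open import Data.Empty using (⊥-elim)
open import Data.List using (filter; map; upTo; _++_; [_])
open import Data.List.Properties using (upTo-∷ʳ; map-++; filter-++; filter-accept; filter-reject)
open import Data.Nat.ListAction using (sum)
open import Data.Nat.ListAction.Properties using (sum-++)
open import Function using (_⇔_; mk⇔; Equivalence)
open import Relation.Nullary using (¬_; yes; no)
open import Relation.Binary.PropositionalEquality hiding ([_])
open ≡-Reasoning
open Equivalence using (to; from)

σ≤ : ℕ → ℕ → ℕ
σ≤ n N = sum (filter (_∣? n) (map suc (upTo N)))

σ≤-suc : ∀ n N → σ≤ n (suc N) ≡ σ≤ n N + sum (filter (_∣? n) [ suc N ])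
σ≤-suc n N = begin
  sum (filter (_∣? n) (map suc (upTo (suc N))))
    ≡⟨ cong (λ l → sum (filter (_∣? n) (map suc l))) (sym (upTo-∷ʳ N)) ⟩
  sum (filter (_∣? n) (map suc (upTo N ++ [ N ])))
    ≡⟨ cong (λ l → sum (filter (_∣? n) l)) (map-++ suc (upTo N) [ N ]) ⟩
  sum (filter (_∣? n) (map suc (upTo N) ++ [ suc N ]))
    ≡⟨ cong sum (filter-++ (_∣? n) (map suc (upTo N)) [ suc N ]) ⟩
  sum (filter (_∣? n) (map suc (upTo N)) ++ filter (_∣? n) [ suc N ])
    ≡⟨ sum-++ (filter (_∣? n) (map suc (upTo N))) _ ⟩
  σ≤ n N + sum (filter (_∣? n) [ suc N ]) ∎

σ≤-suc-∣ : ∀ n N → suc N ∣ n → σ≤ n (suc N) ≡ σ≤ n N + suc N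
σ≤-suc-∣ n N d∣n = begin
  σ≤ n (suc N)                              ≡⟨ σ≤-suc n N ⟩
  σ≤ n N + sum (filter (_∣? n) [ suc N ])   ≡⟨ cong (λ l → σ≤ n N + sum l) (filter-accept (_∣? n) d∣n) ⟩
  σ≤ n N + (suc N + 0)                      ≡⟨ cong (σ≤ n N +_) (+-identityʳ (suc N)) ⟩
  σ≤ n N + suc N                            ∎

σ≤-suc-∤ : ∀ n N → ¬ suc N ∣ n → σ≤ n (suc N) ≡ σ≤ n N
σ≤-suc-∤ n N d∤n = begin
  σ≤ n (suc N)                              ≡⟨ σ≤-suc n N ⟩
  σ≤ n N + sum (filter (_∣? n) [ suc N ])   ≡⟨ cong (λ l → σ≤ n N + sum l) (filter-reject (_∣? n) d∤n) ⟩
  σ≤ n N + 0                                ≡⟨ +-identityʳ (σ≤ n N) ⟩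
  σ≤ n N                                    ∎

σ≤-cong : ∀ {n n′} N → (∀ {d} → d ≤ N → d ∣ n ⇔ d ∣ n′) → σ≤ n N ≡ σ≤ n′ N
σ≤-cong zero same = refl
σ≤-cong {n} {n′} (suc N) same with suc N ∣? n
... | yes N+1∣n = begin
  σ≤ n (suc N)     ≡⟨ σ≤-suc-∣ n N N+1∣n ⟩
  σ≤ n N + suc N   ≡⟨ cong (_+ suc N) (σ≤-cong N (λ d≤N → same (m≤n⇒m≤1+n d≤N))) ⟩
  σ≤ n′ N + suc N  ≡⟨ sym (σ≤-suc-∣ n′ N (to (same ≤-refl) N+1∣n)) ⟩
  σ≤ n′ (suc N)    ∎
... | no N+1∤n = begin
  σ≤ n (suc N)     ≡⟨ σ≤-suc-∤ n N N+1∤n ⟩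
  σ≤ n N           ≡⟨ σ≤-cong N (λ d≤N → same (m≤n⇒m≤1+n d≤N)) ⟩
  σ≤ n′ N          ≡⟨ sym (σ≤-suc-∤ n′ N (λ N+1∣n′ → N+1∤n (from (same ≤-refl) N+1∣n′))) ⟩
  σ≤ n′ (suc N)    ∎

σ≤-beyond : ∀ n .{{_ : NonZero n}} j → σ≤ n (n + j) ≡ σ n
σ≤-beyond n zero = cong (σ≤ n) (+-identityʳ n)
σ≤-beyond n (suc j) = begin
  σ≤ n (n + suc j)   ≡⟨ cong (σ≤ n) (+-suc n j) ⟩
  σ≤ n (suc (n + j)) ≡⟨ σ≤-suc-∤ n (n + j) (λ d∣n → <⇒≱ (s≤s (m≤m+n n j)) (∣⇒≤ d∣n)) ⟩
  σ≤ n (n + j)       ≡⟨ σ≤-beyond n j ⟩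
  σ n                ∎

σ-by-proper-divisors : ∀ {n m} .{{_ : NonZero n}} .{{_ : NonZero m}} → m < n →
                       (∀ {d} → d < n → d ∣ n ⇔ d ∣ m) → σ n ≡ σ m + n
σ-by-proper-divisors {suc N} {m} m<n same = begin
  σ≤ (suc N) (suc N)         ≡⟨ σ≤-suc-∣ (suc N) N ∣-refl ⟩
  σ≤ (suc N) N + suc N       ≡⟨ cong (_+ suc N) (σ≤-cong N (λ d≤N → same (s≤s d≤N))) ⟩
  σ≤ m N + suc N             ≡⟨ cong (λ x → σ≤ m x + suc N) (sym (m+[n∸m]≡n (s≤s⁻¹ m<n))) ⟩
  σ≤ m (m + (N ∸ m)) + suc N ≡⟨ cong (_+ suc N) (σ≤-beyond m (N ∸ m)) ⟩
  σ m + suc N                ∎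

∣p^[1+k]∧<⇒∣p^k : ∀ {p d} → Prime p → ∀ k → d ∣ p ^ suc k → d < p ^ suc k → d ∣ p ^ k
∣p^[1+k]∧<⇒∣p^k {p} {d} p-prime k d∣ d< with p ∣? d
... | no p∤d = coprime-divisor d-coprime-p d∣
  where
  d-coprime-p : Coprime d p
  d-coprime-p (i∣d , i∣p) with prime⇒irreducible p-prime i∣p
  ... | inj₁ i≡1 = i≡1
  ... | inj₂ refl = ⊥-elim (p∤d i∣d)
... | yes (divides q refl) = q*p∣p^k k q∣p^k q<p^k
  where
  instance _ = prime⇒nonZero p-prime
  q∣p^k : q ∣ p ^ k
  q∣p^k = *-cancelˡ-∣ p (subst (_∣ p ^ suc k) (*-comm q p) d∣)
  q<p^k : q < p ^ k
  q<p^k = *-cancelˡ-< p q (p ^ k) (subst (_< p ^ suc k) (*-comm q p) d<)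
  q*p∣p^k : ∀ k → q ∣ p ^ k → q < p ^ k → q * p ∣ p ^ k
  q*p∣p^k zero q∣1 q<1 = ⊥-elim (1+n≢0 (0∣⇒≡0 (subst (_∣ 1) (n<1⇒n≡0 q<1) q∣1)))
  q*p∣p^k (suc k) q∣ q< = subst (_∣ p ^ suc k) (*-comm p q)
    (*-monoʳ-∣ p (∣p^[1+k]∧<⇒∣p^k p-prime k q∣ q<))

geometric : ℕ → ℕ → ℕ
geometric p zero    = 1
geometric p (suc k) = geometric p k + p ^ suc k

geometric-suc : ∀ p k → geometric p (suc k) ≡ 1 + p * geometric p k
geometric-suc p zero = refl
geometric-suc p (suc k) = begin
  geometric p (suc k) + p ^ suc (suc k)   ≡⟨ cong (_+ p ^ suc (suc k)) (geometric-suc p k) ⟩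
  1 + p * geometric p k + p * p ^ suc k   ≡⟨ +-assoc 1 (p * geometric p k) _ ⟩
  1 + (p * geometric p k + p * p ^ suc k) ≡⟨ cong (1 +_) (sym (*-distribˡ-+ p (geometric p k) _)) ⟩
  1 + p * (geometric p k + p ^ suc k)     ∎

σ[p^k]≡geometric : ∀ {p} → Prime p → ∀ k → σ (p ^ k) ≡ geometric p k
σ[p^k]≡geometric p-prime zero = refl
σ[p^k]≡geometric {p} p-prime (suc k) = begin
  σ (p ^ suc k)           ≡⟨ σ-by-proper-divisors (^-monoʳ-< p 1<p (n<1+n k)) same-divisors ⟩
  σ (p ^ k) + p ^ suc k   ≡⟨ cong (_+ p ^ suc k) (σ[p^k]≡geometric p-prime k) ⟩
  geometric p (suc k)     ∎
  where
  instance
    _ = prime⇒nonZero p-prime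
    _ = m^n≢0 p k
    _ = m^n≢0 p (suc k)
  1<p : 1 < p
  1<p = nonTrivial⇒n>1 p {{prime⇒nonTrivial p-prime}}
  same-divisors : ∀ {d} → d < p ^ suc k → d ∣ p ^ suc k ⇔ d ∣ p ^ k
  same-divisors d< = mk⇔ (λ d∣ → ∣p^[1+k]∧<⇒∣p^k p-prime k d∣ d<) (∣n⇒∣m*n p)

1+*-cong-% : ∀ n .{{_ : NonZero n}} {a a′ b b′} → a % n ≡ a′ % n → b % n ≡ b′ % n →
             (1 + a * b) % n ≡ (1 + a′ * b′) % n
1+*-cong-% n {a} {a′} {b} {b′} a≡a′ b≡b′ = begin
  (1 + a * b) % n                               ≡⟨ %-distribˡ-+ 1 (a * b) n ⟩
  (1 % n + a * b % n) % n                       ≡⟨ cong (λ x → (1 % n + x) % n) (%-distribˡ-* a b n) ⟩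
  (1 % n + (a % n) * (b % n) % n) % n           ≡⟨ cong₂ (λ x y → (1 % n + x * y % n) % n) a≡a′ b≡b′ ⟩
  (1 % n + (a′ % n) * (b′ % n) % n) % n         ≡⟨ cong (λ x → (1 % n + x) % n) (sym (%-distribˡ-* a′ b′ n)) ⟩
  (1 % n + a′ * b′ % n) % n                     ≡⟨ sym (%-distribˡ-+ 1 (a′ * b′) n) ⟩
  (1 + a′ * b′) % n                             ∎

geometric-suc-cong-% : ∀ n .{{_ : NonZero n}} {p p′} k k′ → p % n ≡ p′ % n →
                       geometric p k % n ≡ geometric p′ k′ % n →
                       geometric p (suc k) % n ≡ geometric p′ (suc k′) % n
geometric-suc-cong-% n {p} {p′} k k′ p≡p′ g≡g′ = begin
  geometric p (suc k) % n        ≡⟨ cong (_% n) (geometric-suc p k) ⟩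
  (1 + p * geometric p k) % n    ≡⟨ 1+*-cong-% n p≡p′ g≡g′ ⟩
  (1 + p′ * geometric p′ k′) % n ≡⟨ cong (_% n) (sym (geometric-suc p′ k′)) ⟩
  geometric p′ (suc k′) % n      ∎

geometric-% : ∀ n .{{_ : NonZero n}} p k → geometric p k % n ≡ geometric (p % n) k % n
geometric-% n p zero = refl
geometric-% n p (suc k) =
  geometric-suc-cong-% n k k (sym (m%n%n≡m%n p n)) (geometric-% n p k)

geometric-shift-% : ∀ n .{{_ : NonZero n}} {p} m → geometric p m % n ≡ 1 % n →
                    ∀ k → geometric p (k + m) % n ≡ geometric p k % n
geometric-shift-% n m period zero = period
geometric-shift-% n m period (suc k) =
  geometric-suc-cong-% n (k + m) k refl (geometric-shift-% n m period k)

geometric-periodic-% : ∀ n .{{_ : NonZero n}} {p} m .{{_ : NonZero m}} →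
                       geometric p m % n ≡ 1 % n →
                       ∀ k → geometric p k % n ≡ geometric p (k % m) % n
geometric-periodic-% n {p} m period k = begin
  geometric p k % n                     ≡⟨ cong (λ i → geometric p i % n) (m≡m%n+[m/n]*n k m) ⟩
  geometric p (k % m + k / m * m) % n   ≡⟨ drop-periods (k % m) (k / m) ⟩
  geometric p (k % m) % n               ∎
  where
  drop-periods : ∀ r q → geometric p (r + q * m) % n ≡ geometric p r % n
  drop-periods r zero = cong (λ i → geometric p i % n) (+-identityʳ r)
  drop-periods r (suc q) = begin
    geometric p (r + (m + q * m)) % n  ≡⟨ cong (λ i → geometric p i % n) (+-comm r (m + q * m)) ⟩
    geometric p (m + q * m + r) % n    ≡⟨ cong (λ i → geometric p i % n) (+-assoc m (q * m) r) ⟩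
    geometric p (m + (q * m + r)) % n  ≡⟨ cong (λ i → geometric p i % n) (+-comm m (q * m + r)) ⟩
    geometric p (q * m + r + m) % n    ≡⟨ geometric-shift-% n m period (q * m + r) ⟩
    geometric p (q * m + r) % n        ≡⟨ cong (λ i → geometric p i % n) (+-comm (q * m) r) ⟩
    geometric p (r + q * m) % n        ≡⟨ drop-periods r q ⟩
    geometric p r % n                  ∎

geometric-1 : ∀ k → geometric 1 k ≡ suc k
geometric-1 zero = refl
geometric-1 (suc k) = begin
  geometric 1 k + 1 ^ suc k ≡⟨ cong₂ _+_ (geometric-1 k) (^-zeroˡ (suc k)) ⟩
  suc k + 1                 ≡⟨ +-comm (suc k) 1 ⟩
  suc (suc k)               ∎

geometric-%8-p≡1 : ∀ {p} k → p % 8 ≡ 1 → geometric p k % 8 ≡ (k + 1) % 8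
geometric-%8-p≡1 {p} k p≡1 = begin
  geometric p k % 8        ≡⟨ geometric-% 8 p k ⟩
  geometric (p % 8) k % 8  ≡⟨ cong (λ x → geometric x k % 8) p≡1 ⟩
  geometric 1 k % 8        ≡⟨ cong (_% 8) (trans (geometric-1 k) (+-comm 1 k)) ⟩
  (k + 1) % 8              ∎

geometric-%8-p≡5 : ∀ {p} k {r} → p % 8 ≡ 5 → k % 8 ≡ r → geometric p k % 8 ≡ geometric 5 r % 8
geometric-%8-p≡5 {p} k {r} p≡5 k≡r = begin
  geometric p k % 8        ≡⟨ geometric-% 8 p k ⟩
  geometric (p % 8) k % 8  ≡⟨ cong (λ x → geometric x k % 8) p≡5 ⟩
  geometric 5 k % 8        ≡⟨ geometric-periodic-% 8 8 refl k ⟩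
  geometric 5 (k % 8) % 8  ≡⟨ cong (λ i → geometric 5 i % 8) k≡r ⟩
  geometric 5 r % 8        ∎

lemma1 : (n p k m : ℕ) → OddPerfect n → n ≡ p ^ k * (m * m) → Prime p →
    p % 4 ≡ 1 → k % 4 ≡ 1 → Coprime p m →
    ((p % 8 ≡ 1 → σ (p ^ k) % 8 ≡ (k + 1) % 8)
    × (p % 8 ≡ 5 → k % 8 ≡ 1 → σ (p ^ k) % 8 ≡ 6)
    × (p % 8 ≡ 5 → k % 8 ≡ 5 → σ (p ^ k) % 8 ≡ 2))
lemma1 n p k m _ _ p-prime _ _ _ =
    (λ p≡1 → trans σ≡ (geometric-%8-p≡1 k p≡1))
  , (λ p≡5 k≡1 → trans σ≡ (geometric-%8-p≡5 k p≡5 k≡1))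
  , (λ p≡5 k≡5 → trans σ≡ (geometric-%8-p≡5 k p≡5 k≡5))
  where
  σ≡ : σ (p ^ k) % 8 ≡ geometric p k % 8
  σ≡ = cong (_% 8) (σ[p^k]≡geometric p-prime k)
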